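{- Let $F$ be a clause-set. Then the map $F' \mapsto \mathrm{pure}(D_F(F'))$ is a bijection from $\mathrm{mps}(F)$ to $\mathrm{prc}_0(D(F))$.
   Context: Clauses are finite sets of literals without complementary pair; clause-sets are finite sets of clauses; $\top$ is the empty clause-set. $F\models C$ means every satisfying assignment of $F$ satisfies $C$. $\mathrm{prc}_0(G)$ is the set of prime implicates of $G$ (inclusion-minimal clauses $C$ with $G \models C$). A clause-set $G$ is a minimal premise set (mps) for a clause $C$ if $G \models C$ and no proper subset $G' \subset G$ satisfies $G'\models C$; $G$ is an mps if it is an mps for some clause; $\mathrm{mps}(F)$ denotes the set of subsets of $F$ that are mps's. $\mathrm{pure}(G)$ is the set of pure literals of $G$: literals occurring in some clause of $G$ whose complement occurs in no clause of $G$. Doping: for the clause-set $F$ fix an injection assigning to each $C\in F$ a variable $u_C \notin \mathrm{var}(F)$, distinct for distinct clauses; $D(F) := \{C\cup\{u_C\} : C\in F\}$ and for $F'\subseteq F$, $D_F(F') := \{C \cup\{u_C\} : C \in F'\}$. -}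

module Defs where

open import Data.Nat using (ℕ)
import Data.Nat as ℕ
open import Data.Bool using (Bool; true; false; not)
import Data.Bool as B
open import Data.Product using (_×_; _,_; Σ; ∃; ∃-syntax)
open import Data.Product.Properties using (≡-dec)
open import Data.List using (List; _∷_; []; map; concat; filter)
open import Data.List.Membership.Propositional using (_∈_; _∉_)
open import Data.List.Membership.DecPropositional (≡-dec ℕ._≟_ B._≟_) using (_∈?_)
open import Data.List.Relation.Unary.Any using (Any)
open import Relation.Nullary using (¬_)
open import Relation.Nullary.Decidable using (¬?)
open import Relation.Binary.PropositionalEquality using (_≡_)

-- Variables are natural numbers; a literal is a pair (variable , sign),
-- where sign true = positive literal v, sign false = negative literal ¬v.
Lit : Set
Lit = ℕ × Bool

comp : Lit → Lit
comp (v , b) = (v , not b)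

-- A clause is represented by a list of literals, read as the finite SET of
-- its elements (duplicates and order irrelevant).
Clause : Set
Clause = List Lit

IsClause : Clause → Set
IsClause C = ∀ x → x ∈ C → comp x ∉ C

_⊆ᶜ_ : Clause → Clause → Set
C ⊆ᶜ D = ∀ x → x ∈ C → x ∈ D

_≈ᶜ_ : Clause → Clause → Set
C ≈ᶜ D = C ⊆ᶜ D × D ⊆ᶜ C

-- A clause-set is a list of clauses, read as a finite set of clauses
-- (clauses compared as sets).
ClauseSet : Set
ClauseSet = List Clause

IsClauseSet : ClauseSet → Set
IsClauseSet F = ∀ C → C ∈ F → IsClause C

_∈ₛ_ : Clause → ClauseSet → Set
C ∈ₛ F = Any (C ≈ᶜ_) F

_⊆ₛ_ : ClauseSet → ClauseSet → Set
G ⊆ₛ H = ∀ C → C ∈ G → C ∈ₛ H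

_≋_ : ClauseSet → ClauseSet → Set
G ≋ H = G ⊆ₛ H × H ⊆ₛ G

Assignment : Set
Assignment = ℕ → Bool

LitTrue : Assignment → Lit → Set
LitTrue α (v , b) = α v ≡ b

SatC : Assignment → Clause → Set
SatC α C = ∃[ x ] (x ∈ C × LitTrue α x)

SatF : Assignment → ClauseSet → Set
SatF α F = ∀ C → C ∈ F → SatC α C

_⊨_ : ClauseSet → Clause → Set
F ⊨ C = ∀ (α : Assignment) → SatF α F → SatC α C

IsPrimeImplicate : ClauseSet → Clause → Set
IsPrimeImplicate G C =
  IsClause C × G ⊨ C × (∀ C' → C' ⊆ᶜ C → G ⊨ C' → C ⊆ᶜ C')

IsMpsFor : ClauseSet → Clause → Set
IsMpsFor G C =
  IsClause C × G ⊨ C × (∀ G' → G' ⊆ₛ G → ¬ (G ⊆ₛ G') → ¬ (G' ⊨ C))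

IsMps : ClauseSet → Set
IsMps G = ∃[ C ] IsMpsFor G C

InMps : ClauseSet → ClauseSet → Set
InMps F G = G ⊆ₛ F × IsMps G

VarOf : ℕ → ClauseSet → Set
VarOf v F = ∃[ C ] (C ∈ F × ∃[ b ] ((v , b) ∈ C))

pure : ClauseSet → Clause
pure G = filter (λ x → ¬? (comp x ∈? concat G)) (concat G)

record Doping (F : ClauseSet) : Set where
  field
    u     : Clause → ℕ
    resp  : ∀ C D → C ∈ F → C ≈ᶜ D → u C ≡ u D
    inj   : ∀ C D → C ∈ F → D ∈ F → u C ≡ u D → C ≈ᶜ D
    fresh : ∀ C → C ∈ F → ¬ VarOf (u C) F

DF : {F : ClauseSet} → Doping F → ClauseSet → ClauseSet
DF d F' = map (λ C → (Doping.u d C , true) ∷ C) F'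

Dop : {F : ClauseSet} → Doping F → ClauseSet
Dop {F} d = DF d F

-- Write u_D for the doping literal of D and P(G) = pure(D_F(G)); for G ⊆ F,
-- P(G) consists of the u_D with D ∈ G together with pure(G). The key tool is the
-- assignment making u_D false exactly for D ∈ G and true for the other clauses of
-- F: it satisfies D(F) as soon as it satisfies G, so if D(F) implies a clause
-- whose doping literals it falsifies, G implies the rest of that clause.
-- Conversely G ⊨ C₀ gives D(F) ⊨ C₀ ∪ {u_D : D ∈ G}. An mps G of C satisfies
-- pure(G) ⊆ C and G ⊨ pure(G), because a clause containing a pure literal outside
-- C, or the complement of a literal of C, could be dropped from G. Hence P(G) is
-- a prime implicate of D(F) determined by its doping literals, and a prime
-- implicate C of D(F) is P(G) for G = {D ∈ F : u_D ∈ C}.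
module Submission where

open import Defs
open import Data.Nat using (ℕ)
import Data.Nat as ℕ
open import Data.Bool using (Bool; true; false; not)
import Data.Bool as B
open import Data.Bool.Properties using (not-¬; ¬-not)
open import Data.Product using (_×_; _,_; ∃-syntax; proj₁; proj₂)
open import Data.Product.Properties using (≡-dec)
open import Data.Sum using (_⊎_; inj₁; inj₂; [_,_]′)
open import Data.Empty using (⊥-elim)
open import Data.List using (List; _∷_; []; map; concat; filter)
open import Data.List.Membership.Propositional using (_∈_; _∉_; find; lose)
open import Data.List.Membership.Propositional.Properties
  using (∈-map⁺; ∈-map⁻; ∈-concat⁺′; ∈-concat⁻′; ∈-filter⁺; ∈-filter⁻)
open import Data.List.Membership.DecPropositional (≡-dec ℕ._≟_ B._≟_) using (_∈?_)
import Data.List.Membership.DecPropositional ℕ._≟_ as ℕ∈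
open import Data.List.Relation.Unary.All using (all?; lookup; tabulate)
open import Data.List.Relation.Unary.All.Properties using (¬All⇒Any¬)
open import Data.List.Relation.Unary.Any using (here; there; any?)
open import Relation.Nullary using (¬_; Dec; yes; no; does)
open import Relation.Nullary.Decidable using (¬?; _×-dec_; map′; dec-true; dec-false)
open import Relation.Binary.PropositionalEquality using (_≡_; _≢_; refl; sym; trans; cong; subst)

_≟ₗ_ : (x y : Lit) → Dec (x ≡ y)
_≟ₗ_ = ≡-dec ℕ._≟_ B._≟_

comp-involutive : ∀ x → comp (comp x) ≡ x
comp-involutive (v , true)  = refl
comp-involutive (v , false) = refl

same-var : ∀ x y → proj₁ y ≡ proj₁ x → y ≡ x ⊎ y ≡ comp x
same-var (v , true)  (.v , true)  refl = inj₁ refl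
same-var (v , true)  (.v , false) refl = inj₂ refl
same-var (v , false) (.v , true)  refl = inj₂ refl
same-var (v , false) (.v , false) refl = inj₁ refl

≈ᶜ-refl : ∀ {C} → C ≈ᶜ C
≈ᶜ-refl = (λ _ m → m) , (λ _ m → m)

≈ᶜ-sym : ∀ {C D} → C ≈ᶜ D → D ≈ᶜ C
≈ᶜ-sym (C⊆D , D⊆C) = D⊆C , C⊆D

≈ᶜ-trans : ∀ {C D E} → C ≈ᶜ D → D ≈ᶜ E → C ≈ᶜ E
≈ᶜ-trans (C⊆D , D⊆C) (D⊆E , E⊆D) = (λ x m → D⊆E x (C⊆D x m)) , (λ x m → D⊆C x (E⊆D x m))

_⊆ᶜ?_ : (C D : Clause) → Dec (C ⊆ᶜ D)
C ⊆ᶜ? D = map′ (λ all _ → lookup all) (λ C⊆D → tabulate (C⊆D _)) (all? (_∈? D) C)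

_≈ᶜ?_ : (C D : Clause) → Dec (C ≈ᶜ D)
C ≈ᶜ? D = (C ⊆ᶜ? D) ×-dec (D ⊆ᶜ? C)

_∈ₛ?_ : (C : Clause) (G : ClauseSet) → Dec (C ∈ₛ G)
C ∈ₛ? G = any? (C ≈ᶜ?_) G

⊈ₛ-witness : ∀ {G H} → ¬ (G ⊆ₛ H) → ∃[ D ] (D ∈ G × ¬ D ∈ₛ H)
⊈ₛ-witness {G} {H} G⊈H = find (¬All⇒Any¬ (_∈ₛ? H) G (λ all → G⊈H (λ _ → lookup all)))

⊆ₛ-trans : ∀ {G H K} → G ⊆ₛ H → H ⊆ₛ K → G ⊆ₛ K
⊆ₛ-trans G⊆H H⊆K C C∈G =
  let D , D∈H , C≈D = find (G⊆H C C∈G)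
      E , E∈K , D≈E = find (H⊆K D D∈H)
  in lose E∈K (≈ᶜ-trans C≈D D≈E)

IsClause-⊆ : ∀ {C D} → IsClause D → C ⊆ᶜ D → IsClause C
IsClause-⊆ hD C⊆D x x∈C cx∈C = hD x (C⊆D x x∈C) (C⊆D _ cx∈C)

pure⁻ : ∀ G {x} → x ∈ pure G → x ∈ concat G × comp x ∉ concat G
pure⁻ G = ∈-filter⁻ (λ x → ¬? (comp x ∈? concat G))

pure⁺ : ∀ G {x} → x ∈ concat G → comp x ∉ concat G → x ∈ pure G
pure⁺ G = ∈-filter⁺ (λ x → ¬? (comp x ∈? concat G))

pure-isClause : ∀ G → IsClause (pure G)
pure-isClause G x x∈P cx∈P = proj₂ (pure⁻ G x∈P) (proj₁ (pure⁻ G cx∈P))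

LitTrue? : ∀ α x → Dec (LitTrue α x)
LitTrue? α (v , b) = α v B.≟ b

LitTrue-comp : ∀ {α} x → LitTrue α x → ¬ LitTrue α (comp x)
LitTrue-comp (v , b) t t′ = not-¬ t t′

¬LitTrue-comp : ∀ {α} x → ¬ LitTrue α x → LitTrue α (comp x)
¬LitTrue-comp (v , b) = ¬-not

SatC-⊆ : ∀ {α C D} → C ⊆ᶜ D → SatC α C → SatC α D
SatC-⊆ C⊆D (x , x∈C , t) = x , C⊆D x x∈C , t

SatF-⊆ₛ : ∀ {α G H} → G ⊆ₛ H → SatF α H → SatF α G
SatF-⊆ₛ G⊆H s C C∈G = let D , D∈H , C≈D = find (G⊆H C C∈G) in SatC-⊆ (proj₂ C≈D) (s D D∈H)

⊨-mono : ∀ {G H C} → G ⊆ₛ H → G ⊨ C → H ⊨ C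
⊨-mono G⊆H G⊨C α s = G⊨C α (SatF-⊆ₛ G⊆H s)

patch : List ℕ → (ℕ → Bool) → Assignment → Assignment
patch vs f α v with v ℕ∈.∈? vs
... | yes _ = f v
... | no _  = α v

patch-∈ : ∀ {vs v} f α → v ∈ vs → patch vs f α v ≡ f v
patch-∈ {vs} {v} _ _ v∈vs with v ℕ∈.∈? vs
... | yes _    = refl
... | no v∉vs = ⊥-elim (v∉vs v∈vs)

patch-∉ : ∀ {vs v} f α → v ∉ vs → patch vs f α v ≡ α v
patch-∉ {vs} {v} _ _ v∉vs with v ℕ∈.∈? vs
... | yes v∈vs = ⊥-elim (v∉vs v∈vs)
... | no _     = refl

setTrue : Lit → Assignment → Assignment
setTrue (v , b) = patch (v ∷ []) (λ _ → b)

setTrue-sat : ∀ x α → LitTrue (setTrue x α) x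
setTrue-sat (v , b) α = patch-∈ {v ∷ []} (λ _ → b) α (here refl)

setTrue-off : ∀ {x α y} → y ≢ x → y ≢ comp x → setTrue x α (proj₁ y) ≡ α (proj₁ y)
setTrue-off {x} {α} {y} y≢x y≢cx =
  patch-∉ {proj₁ x ∷ []} (λ _ → proj₂ x) α λ { (here e) → [ y≢x , y≢cx ]′ (same-var x y e) }

setTrue-keep : ∀ {x α y} → y ≢ comp x → LitTrue α y → LitTrue (setTrue x α) y
setTrue-keep {x} {α} {y} y≢cx t with y ≟ₗ x
... | yes refl = setTrue-sat x α
... | no y≢x   = trans (setTrue-off y≢x y≢cx) t

setTrue-back : ∀ {x α y} → y ≢ x → y ≢ comp x → LitTrue (setTrue x α) y → LitTrue α y
setTrue-back y≢x y≢cx t = trans (sym (setTrue-off y≢x y≢cx)) t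

falsifyingValue : Clause → ℕ → Bool
falsifyingValue C v = not (does ((v , true) ∈? C))

falsify : Clause → Assignment → Assignment
falsify C = patch (map proj₁ C) (falsifyingValue C)

falsify-∈ : ∀ {C α} → IsClause C → ∀ y → y ∈ C → ¬ LitTrue (falsify C α) y
falsify-∈ {C} {α} hC (v , b) y∈C t = not-¬ t (trans value (cong not (sign b y∈C)))
  where
  value : falsify C α v ≡ falsifyingValue C v
  value = patch-∈ (falsifyingValue C) α (∈-map⁺ proj₁ y∈C)
  sign : ∀ b → (v , b) ∈ C → does ((v , true) ∈? C) ≡ b
  sign true  y∈C = dec-true ((v , true) ∈? C) y∈C
  sign false y∈C = dec-false ((v , true) ∈? C) (hC _ y∈C)

falsify-∉ : ∀ {C α y} → y ∉ C → comp y ∉ C → falsify C α (proj₁ y) ≡ α (proj₁ y)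
falsify-∉ {C} {α} {y} y∉C cy∉C = patch-∉ (falsifyingValue C) α var∉
  where
  var∉ : proj₁ y ∉ map proj₁ C
  var∉ v∈ with ∈-map⁻ proj₁ v∈
  ... | z , z∈C , e with same-var z y e
  ...   | inj₁ refl = y∉C z∈C
  ...   | inj₂ refl = cy∉C (subst (_∈ C) (sym (comp-involutive z)) z∈C)

remove : Lit → Clause → Clause
remove x C = filter (λ y → ¬? (y ≟ₗ x)) C

remove⁻ : ∀ x C {y} → y ∈ remove x C → y ∈ C × y ≢ x
remove⁻ x _ = ∈-filter⁻ (λ y → ¬? (y ≟ₗ x))

remove⁺ : ∀ {x C y} → y ∈ C → y ≢ x → y ∈ remove x C
remove⁺ {x} = ∈-filter⁺ (λ y → ¬? (y ≟ₗ x))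

rm : Clause → ClauseSet → ClauseSet
rm D G = filter (λ E → ¬? (D ≈ᶜ? E)) G

rm⁻ : ∀ {D G E} → E ∈ rm D G → E ∈ G × ¬ D ≈ᶜ E
rm⁻ {D} = ∈-filter⁻ (λ E → ¬? (D ≈ᶜ? E))

rm⁺ : ∀ {D G E} → E ∈ G → ¬ D ≈ᶜ E → E ∈ rm D G
rm⁺ {D} = ∈-filter⁺ (λ E → ¬? (D ≈ᶜ? E))

SatF-rm : ∀ {α D G} → SatF α (rm D G) → (∀ E → E ∈ G → D ≈ᶜ E → SatC α E) → SatF α G
SatF-rm {D = D} s sat≈D E E∈G with D ≈ᶜ? E
... | yes D≈E = sat≈D E E∈G D≈E
... | no D≉E  = s E (rm⁺ E∈G D≉E)

mps-rm : ∀ {G C D} → IsMpsFor G C → D ∈ G → ¬ (rm D G ⊨ C)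
mps-rm {G} {D = D} (_ , _ , minimal) D∈G = minimal (rm D G) rm⊆G G⊈rm
  where
  rm⊆G : rm D G ⊆ₛ G
  rm⊆G E m = lose (proj₁ (rm⁻ m)) ≈ᶜ-refl
  G⊈rm : ¬ (G ⊆ₛ rm D G)
  G⊈rm G⊆rm = let E , E∈rm , D≈E = find (G⊆rm D D∈G) in proj₂ (rm⁻ {D} {G} E∈rm) D≈E

-- An assignment falsifying w satisfies every clause containing comp w.
⊨-rm-comp : ∀ {G C D w} → G ⊨ C → w ∈ C → comp w ∈ D → rm D G ⊨ C
⊨-rm-comp {w = w} G⊨C w∈C cw∈D α s with LitTrue? α w
... | yes t = w , w∈C , t
... | no f  = G⊨C α (SatF-rm s (λ E _ D≈E → comp w , proj₁ D≈E _ cw∈D , ¬LitTrue-comp {α} w f))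

-- Setting the pure literal x true keeps every clause of G satisfied and
-- satisfies those containing x; it cannot help C since x ∉ C.
⊨-rm-pure : ∀ {G C D x} → G ⊨ C → x ∈ pure G → x ∉ C → x ∈ D → rm D G ⊨ C
⊨-rm-pure {G} {C} {D} {x} G⊨C x∈P x∉C x∈D α s = back (G⊨C (setTrue x α) satG)
  where
  cx∉G : comp x ∉ concat G
  cx∉G = proj₂ (pure⁻ G x∈P)
  satG : SatF (setTrue x α) G
  satG = SatF-rm
    (λ E E∈rm → let z , z∈E , t = s E E∈rm in
      z , z∈E ,
      setTrue-keep (λ z≡cx → cx∉G (subst (_∈ concat G) z≡cx (∈-concat⁺′ z∈E (proj₁ (rm⁻ {D} {G} E∈rm))))) t)
    (λ E _ D≈E → x , proj₁ D≈E x x∈D , setTrue-sat x α)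
  back : SatC (setTrue x α) C → SatC α C
  back (y , y∈C , t) with y ≟ₗ x | y ≟ₗ comp x
  ... | yes refl | _        = ⊥-elim (x∉C y∈C)
  ... | no _     | yes refl = ⊥-elim (LitTrue-comp {setTrue x α} x (setTrue-sat x α) t)
  ... | no y≢x   | no y≢cx  = y , y∈C , setTrue-back y≢x y≢cx t

mps-comp-∉ : ∀ {G C w} → IsMpsFor G C → w ∈ C → comp w ∉ concat G
mps-comp-∉ {G} mp w∈C cw∈G =
  let D , cw∈D , D∈G = ∈-concat⁻′ G cw∈G in
  mps-rm mp D∈G (⊨-rm-comp (proj₁ (proj₂ mp)) w∈C cw∈D)

mps-pure⊆ : ∀ {G C} → IsMpsFor G C → pure G ⊆ᶜ C
mps-pure⊆ {G} {C} mp x x∈P with x ∈? C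
... | yes x∈C = x∈C
... | no x∉C =
  let D , x∈D , D∈G = ∈-concat⁻′ G (proj₁ (pure⁻ G x∈P)) in
  ⊥-elim (mps-rm mp D∈G (⊨-rm-pure (proj₁ (proj₂ mp)) x∈P x∉C x∈D))

-- If no literal of C occurring in G is true, the assignment falsifying C still
-- satisfies G, since no complement of a literal of C occurs in G.
⊨-through-occurring : ∀ {G C} → IsClause C → G ⊨ C → (∀ w → w ∈ C → comp w ∉ concat G) →
  ∀ α → SatF α G → ∃[ y ] (y ∈ C × y ∈ concat G × LitTrue α y)
⊨-through-occurring {G} {C} hC G⊨C comp∉G α s
  with any? (λ y → (y ∈? concat G) ×-dec LitTrue? α y) C
... | yes found = let y , y∈C , p = find found in y , y∈C , p
... | no none   = let y , y∈C , t = G⊨C (falsify C α) satG in ⊥-elim (falsify-∈ hC y y∈C t)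
  where
  satG : SatF (falsify C α) G
  satG E E∈G with s E E∈G
  ... | z , z∈E , t with z ∈? C | comp z ∈? C
  ...   | yes z∈C | _ = ⊥-elim (none (lose z∈C (∈-concat⁺′ z∈E E∈G , t)))
  ...   | no _ | yes cz∈C =
    ⊥-elim (comp∉G _ cz∈C (subst (_∈ concat G) (sym (comp-involutive z)) (∈-concat⁺′ z∈E E∈G)))
  ...   | no z∉C | no cz∉C = z , z∈E , trans (falsify-∉ z∉C cz∉C) t

mps-⊨-pure : ∀ {G C} → IsMpsFor G C → G ⊨ pure G
mps-⊨-pure {G} mp α s =
  let y , y∈C , y∈G , t =
        ⊨-through-occurring (proj₁ mp) (proj₁ (proj₂ mp)) (λ _ → mps-comp-∉ mp) α s in
  y , pure⁺ G y∈G (mps-comp-∉ mp y∈C) , t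

mps-narrow : ∀ {G C C′} → IsMpsFor G C → C′ ⊆ᶜ C → G ⊨ C′ → IsMpsFor G C′
mps-narrow (hC , _ , minimal) C′⊆C G⊨C′ =
  IsClause-⊆ hC C′⊆C , G⊨C′ ,
  λ G′ G′⊆G G⊈G′ G′⊨C′ → minimal G′ G′⊆G G⊈G′ (λ α s → SatC-⊆ C′⊆C (G′⊨C′ α s))

module Doped {F : ClauseSet} (d : Doping F) where
  open Doping d

  uVars : List ℕ
  uVars = map u F

  doped : Clause → Clause
  doped C = (u C , true) ∷ C

  canonical : ∀ {C} → C ∈ₛ F → ∃[ E ] (E ∈ F × C ≈ᶜ E × u C ≡ u E)
  canonical C∈F = let E , E∈F , C≈E = find C∈F in E , E∈F , C≈E , sym (resp E _ E∈F (≈ᶜ-sym C≈E))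

  u-resp : ∀ {C D} → C ∈ₛ F → C ≈ᶜ D → u C ≡ u D
  u-resp C∈F C≈D = let E , E∈F , C≈E , uC≡uE = canonical C∈F in
    trans uC≡uE (resp E _ E∈F (≈ᶜ-trans (≈ᶜ-sym C≈E) C≈D))

  u-injective : ∀ {C D} → C ∈ₛ F → D ∈ₛ F → u C ≡ u D → C ≈ᶜ D
  u-injective C∈F D∈F uC≡uD =
    let C′ , C′∈F , C≈C′ , uC≡uC′ = canonical C∈F
        D′ , D′∈F , D≈D′ , uD≡uD′ = canonical D∈F
        C′≈D′ = inj C′ D′ C′∈F D′∈F (trans (sym uC≡uC′) (trans uC≡uD uD≡uD′))
    in ≈ᶜ-trans C≈C′ (≈ᶜ-trans C′≈D′ (≈ᶜ-sym D≈D′))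

  u∈uVars : ∀ {C} → C ∈ₛ F → u C ∈ uVars
  u∈uVars C∈F = let E , E∈F , _ , uC≡uE = canonical C∈F in
    subst (_∈ uVars) (sym uC≡uE) (∈-map⁺ u E∈F)

  var∉uVars : ∀ {C x} → C ∈ₛ F → x ∈ C → proj₁ x ∉ uVars
  var∉uVars {x = x} C∈F x∈C v∈ =
    let E , E∈F , C≈E , _ = canonical C∈F
        D , D∈F , v≡uD = ∈-map⁻ u v∈
    in fresh D D∈F (subst (λ v → VarOf v F) v≡uD (E , E∈F , proj₂ x , proj₁ C≈E x x∈C))

  pure-var∉uVars : ∀ {G y} → G ⊆ₛ F → y ∈ pure G → proj₁ y ∉ uVars
  pure-var∉uVars {G} G⊆F y∈P = let D , y∈D , D∈G = ∈-concat⁻′ G (proj₁ (pure⁻ G y∈P)) in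
    var∉uVars (G⊆F D D∈G) y∈D

  ∈-concat-DF⁻ : ∀ {G y} → y ∈ concat (DF d G) → ∃[ D ] (D ∈ G × (y ≡ (u D , true) ⊎ y ∈ D))
  ∈-concat-DF⁻ {G} y∈ with ∈-concat⁻′ (DF d G) y∈
  ... | _ , y∈D′ , D′∈DF with ∈-map⁻ doped D′∈DF
  ...   | D , D∈G , refl with y∈D′
  ...     | here y≡u  = D , D∈G , inj₁ y≡u
  ...     | there y∈D = D , D∈G , inj₂ y∈D

  ∈-concat-DF⁺ : ∀ {G D y} → D ∈ G → y ∈ doped D → y ∈ concat (DF d G)
  ∈-concat-DF⁺ D∈G y∈ = ∈-concat⁺′ y∈ (∈-map⁺ doped D∈G)

  u∈pure-DF : ∀ {G D} → G ⊆ₛ F → D ∈ G → (u D , true) ∈ pure (DF d G)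
  u∈pure-DF {G} {D} G⊆F D∈G = pure⁺ (DF d G) (∈-concat-DF⁺ D∈G (here refl)) neg∉
    where
    neg∉ : (u D , false) ∉ concat (DF d G)
    neg∉ m with ∈-concat-DF⁻ m
    ... | E , E∈G , inj₁ ()
    ... | E , E∈G , inj₂ m′ = var∉uVars (G⊆F E E∈G) m′ (u∈uVars (G⊆F D D∈G))

  pure⊆pure-DF : ∀ {G} → G ⊆ₛ F → pure G ⊆ᶜ pure (DF d G)
  pure⊆pure-DF {G} G⊆F x x∈P =
    let D , x∈D , D∈G = ∈-concat⁻′ G (proj₁ (pure⁻ G x∈P)) in
    pure⁺ (DF d G) (∈-concat-DF⁺ D∈G (there x∈D)) cx∉
    where
    cx∉ : comp x ∉ concat (DF d G)
    cx∉ m with ∈-concat-DF⁻ m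
    ... | E , E∈G , inj₁ cx≡u =
      pure-var∉uVars G⊆F x∈P (subst (_∈ uVars) (sym (cong proj₁ cx≡u)) (u∈uVars (G⊆F E E∈G)))
    ... | E , E∈G , inj₂ m′   = proj₂ (pure⁻ G x∈P) (∈-concat⁺′ m′ E∈G)

  pure-DF⁻ : ∀ G {y} → y ∈ pure (DF d G) → (∃[ D ] (D ∈ G × y ≡ (u D , true))) ⊎ y ∈ pure G
  pure-DF⁻ G {y} y∈P with pure⁻ (DF d G) y∈P
  ... | y∈ , cy∉ with ∈-concat-DF⁻ y∈
  ...   | D , D∈G , inj₁ y≡u = inj₁ (D , D∈G , y≡u)
  ...   | D , D∈G , inj₂ y∈D = inj₂ (pure⁺ G (∈-concat⁺′ y∈D D∈G) cy∉G)
    where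
    cy∉G : comp y ∉ concat G
    cy∉G m = let E , cy∈E , E∈G = ∈-concat⁻′ G m in cy∉ (∈-concat-DF⁺ E∈G (there cy∈E))

  selected : Clause → ClauseSet → ClauseSet
  selected C G = filter (λ D → (u D , true) ∈? C) G

  selected⁻ : ∀ C G {D} → D ∈ selected C G → D ∈ G × (u D , true) ∈ C
  selected⁻ C _ = ∈-filter⁻ (λ D → (u D , true) ∈? C)

  selected⁺ : ∀ {C G D} → D ∈ G → (u D , true) ∈ C → D ∈ selected C G
  selected⁺ {C} = ∈-filter⁺ (λ D → (u D , true) ∈? C)

  selected-⊆ₛ : ∀ {C G} → selected C G ⊆ₛ G
  selected-⊆ₛ {C} {G} D m = lose (proj₁ (selected⁻ C G m)) ≈ᶜ-refl

  strip : Clause → Clause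
  strip C = filter (λ y → ¬? (proj₁ y ℕ∈.∈? uVars)) C

  strip⁻ : ∀ {C y} → y ∈ strip C → y ∈ C × proj₁ y ∉ uVars
  strip⁻ = ∈-filter⁻ (λ y → ¬? (proj₁ y ℕ∈.∈? uVars))

  strip⁺ : ∀ {C y} → y ∈ C → proj₁ y ∉ uVars → y ∈ strip C
  strip⁺ = ∈-filter⁺ (λ y → ¬? (proj₁ y ℕ∈.∈? uVars))

  activate : ClauseSet → Assignment → Assignment
  activate G = patch uVars (λ v → not (does (v ℕ∈.∈? map u G)))

  activate-∈ : ∀ G α {v} → v ∈ uVars → activate G α v ≡ not (does (v ℕ∈.∈? map u G))
  activate-∈ G α = patch-∈ (λ v → not (does (v ℕ∈.∈? map u G))) α

  activate-∉ : ∀ G α {v} → v ∉ uVars → activate G α v ≡ α v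
  activate-∉ G α = patch-∉ (λ v → not (does (v ℕ∈.∈? map u G))) α

  activate-sat : ∀ {G α} → G ⊆ₛ F → SatF α G → SatF (activate G α) (Dop d)
  activate-sat {G} {α} G⊆F s _ m with ∈-map⁻ doped m
  ... | E , E∈F , refl with u E ℕ∈.∈? map u G
  ...   | no uE∉ =
    (u E , true) , here refl , trans (activate-∈ G α (∈-map⁺ u E∈F)) (cong not (dec-false (u E ℕ∈.∈? map u G) uE∉))
  ...   | yes uE∈ =
    let D , D∈G , uE≡uD = ∈-map⁻ u uE∈
        E≈D = u-injective (lose E∈F ≈ᶜ-refl) (G⊆F D D∈G) uE≡uD
        z , z∈D , t = s D D∈G
    in z , there (proj₂ E≈D z z∈D) , trans (activate-∉ G α (var∉uVars (G⊆F D D∈G) z∈D)) t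

  doped-⊨⇒⊨ : ∀ {G C} → G ⊆ₛ F →
    (∀ y → y ∈ C → proj₁ y ∈ uVars → proj₂ y ≡ does (proj₁ y ℕ∈.∈? map u G)) →
    Dop d ⊨ C → G ⊨ strip C
  doped-⊨⇒⊨ {G} {C} G⊆F u-literals-falsified Dop⊨C α s
    with Dop⊨C (activate G α) (activate-sat G⊆F s)
  ... | y , y∈C , t = byVar (proj₁ y ℕ∈.∈? uVars)
    where
    byVar : Dec (proj₁ y ∈ uVars) → SatC α (strip C)
    byVar (yes v∈) = ⊥-elim (not-¬ (u-literals-falsified y y∈C v∈) (trans (sym t) (activate-∈ G α v∈)))
    byVar (no v∉)  = y , strip⁺ y∈C v∉ , trans (sym (activate-∉ G α v∉)) t

  ⊨⇒doped-⊨ : ∀ {G C₀ C} → G ⊆ₛ F → G ⊨ C₀ → C₀ ⊆ᶜ C →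
    (∀ D → D ∈ G → (u D , true) ∈ C) → Dop d ⊨ C
  ⊨⇒doped-⊨ {G} G⊆F G⊨C₀ C₀⊆C u∈C α s with any? (λ D → α (u D) B.≟ true) G
  ... | yes some = let D , D∈G , t = find some in (u D , true) , u∈C D D∈G , t
  ... | no none  = SatC-⊆ C₀⊆C (G⊨C₀ α satG)
    where
    satG : SatF α G
    satG D D∈G with canonical (G⊆F D D∈G)
    ... | E , E∈F , D≈E , uD≡uE with s (doped E) (∈-map⁺ doped E∈F)
    ...   | _ , here refl , t  = ⊥-elim (none (lose D∈G (trans (cong α uD≡uE) t)))
    ...   | z , there z∈E , t = z , proj₂ D≈E z z∈E , t

  ⊨-pure-DF : ∀ {G} → G ⊆ₛ F → IsMps G → Dop d ⊨ pure (DF d G)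
  ⊨-pure-DF G⊆F (_ , mp) = ⊨⇒doped-⊨ G⊆F (mps-⊨-pure mp) (pure⊆pure-DF G⊆F) (λ _ → u∈pure-DF G⊆F)

  -- G is also an mps of the doping-free part of C′, which lies in pure(G) ⊆ C;
  -- its clauses whose doping literal is in C′ imply that part, so they are all of G.
  pure-DF-minimal : ∀ {G C} → G ⊆ₛ F → IsMpsFor G C →
    ∀ C′ → C′ ⊆ᶜ pure (DF d G) → Dop d ⊨ C′ → pure (DF d G) ⊆ᶜ C′
  pure-DF-minimal {G} {C} G⊆F mp C′ C′⊆P Dop⊨C′ = P⊆C′
    where
    Gₛ : ClauseSet
    Gₛ = selected C′ G

    u-literals-falsified : ∀ y → y ∈ C′ → proj₁ y ∈ uVars → proj₂ y ≡ does (proj₁ y ℕ∈.∈? map u Gₛ)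
    u-literals-falsified y y∈C′ v∈ with pure-DF⁻ G (C′⊆P y y∈C′)
    ... | inj₁ (D , D∈G , refl) = sym (dec-true (u D ℕ∈.∈? map u Gₛ) (∈-map⁺ u (selected⁺ D∈G y∈C′)))
    ... | inj₂ y∈P = ⊥-elim (pure-var∉uVars G⊆F y∈P v∈)

    Gₛ⊨ : Gₛ ⊨ strip C′
    Gₛ⊨ = doped-⊨⇒⊨ (⊆ₛ-trans selected-⊆ₛ G⊆F) u-literals-falsified Dop⊨C′

    strip⊆C : strip C′ ⊆ᶜ C
    strip⊆C y m with strip⁻ m
    ... | y∈C′ , v∉ with pure-DF⁻ G (C′⊆P y y∈C′)
    ...   | inj₁ (D , D∈G , refl) = ⊥-elim (v∉ (u∈uVars (G⊆F D D∈G)))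
    ...   | inj₂ y∈P = mps-pure⊆ mp y y∈P

    mp′ : IsMpsFor G (strip C′)
    mp′ = mps-narrow mp strip⊆C (⊨-mono selected-⊆ₛ Gₛ⊨)

    P⊆C′ : pure (DF d G) ⊆ᶜ C′
    P⊆C′ y y∈P with pure-DF⁻ G y∈P
    ... | inj₂ y∈PG = proj₁ (strip⁻ (mps-pure⊆ mp′ y y∈PG))
    ... | inj₁ (D , D∈G , refl) with (u D , true) ∈? C′
    ...   | yes uD∈C′ = uD∈C′
    ...   | no uD∉C′  = ⊥-elim (proj₂ (proj₂ mp′) Gₛ selected-⊆ₛ G⊈Gₛ Gₛ⊨)
      where
      G⊈Gₛ : ¬ (G ⊆ₛ Gₛ)
      G⊈Gₛ G⊆Gₛ = let D′ , D′∈Gₛ , D≈D′ = find (G⊆Gₛ D D∈G) in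
        uD∉C′ (subst (λ v → (v , true) ∈ C′) (sym (u-resp (G⊆F D D∈G) D≈D′))
                     (proj₂ (selected⁻ C′ G D′∈Gₛ)))

  pure-DF-prime : ∀ {G} → InMps F G → IsPrimeImplicate (Dop d) (pure (DF d G))
  pure-DF-prime {G} (G⊆F , C , mp) =
    pure-isClause (DF d G) , ⊨-pure-DF G⊆F (C , mp) , pure-DF-minimal G⊆F mp

  pure-DF-reflects-⊆ : ∀ {G₁ G₂} → G₁ ⊆ₛ F → G₂ ⊆ₛ F → pure (DF d G₁) ⊆ᶜ pure (DF d G₂) → G₁ ⊆ₛ G₂
  pure-DF-reflects-⊆ {G₁} {G₂} G₁⊆F G₂⊆F P₁⊆P₂ C C∈G₁
    with pure-DF⁻ G₂ (P₁⊆P₂ _ (u∈pure-DF G₁⊆F C∈G₁))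
  ... | inj₁ (D , D∈G₂ , uC≡uD) =
    lose D∈G₂ (u-injective (G₁⊆F C C∈G₁) (G₂⊆F D D∈G₂) (cong proj₁ uC≡uD))
  ... | inj₂ y∈P = ⊥-elim (pure-var∉uVars G₂⊆F y∈P (u∈uVars (G₁⊆F C C∈G₁)))

  module _ {C : Clause} (prime : IsPrimeImplicate (Dop d) C) where
    private
      hC = proj₁ prime
      Dop⊨C = proj₁ (proj₂ prime)
      minimalC = proj₂ (proj₂ prime)

    Gᶜ : ClauseSet
    Gᶜ = selected C F

    u-literals-falsified : ∀ y → y ∈ C → proj₁ y ∈ uVars → proj₂ y ≡ does (proj₁ y ℕ∈.∈? map u Gᶜ)
    u-literals-falsified (v , b) y∈C v∈ with ∈-map⁻ u v∈
    u-literals-falsified (_ , true) y∈C _ | E , E∈F , refl =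
      sym (dec-true (u E ℕ∈.∈? map u Gᶜ) (∈-map⁺ u (selected⁺ E∈F y∈C)))
    u-literals-falsified (_ , false) y∈C _ | E , E∈F , refl =
      sym (dec-false (u E ℕ∈.∈? map u Gᶜ) uE∉)
      where
      uE∉ : u E ∉ map u Gᶜ
      uE∉ uE∈ = let D , D∈G , uE≡uD = ∈-map⁻ u uE∈ in
        hC _ y∈C (subst (λ w → (w , true) ∈ C) (sym uE≡uD) (proj₂ (selected⁻ C F D∈G)))

    -- Removing u_D, for a clause D of Gᶜ missing from G′, still leaves a clause
    -- implied by D(F), which contradicts primality.
    selected-minimal : ∀ G′ → G′ ⊆ₛ Gᶜ → ¬ (Gᶜ ⊆ₛ G′) → ¬ (G′ ⊨ strip C)
    selected-minimal G′ G′⊆G G⊈G′ G′⊨ with ⊈ₛ-witness G⊈G′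
    ... | D , D∈G , D∉G′ = proj₂ (remove⁻ uD C (C⊆C⁻ uD uD∈C)) refl
      where
      uD = (u D , true)
      uD∈C = proj₂ (selected⁻ C F D∈G)
      C⁻ = remove uD C
      D∈F = lose (proj₁ (selected⁻ C F D∈G)) ≈ᶜ-refl
      G′⊆F = ⊆ₛ-trans G′⊆G selected-⊆ₛ

      strip⊆C⁻ : strip C ⊆ᶜ C⁻
      strip⊆C⁻ y m = let y∈C , v∉ = strip⁻ {C} m in
        remove⁺ {uD} {C} y∈C (λ { refl → v∉ (u∈uVars D∈F) })

      u∈C⁻ : ∀ D₁ → D₁ ∈ G′ → (u D₁ , true) ∈ C⁻
      u∈C⁻ D₁ D₁∈G′ = remove⁺ {uD} {C} uD₁∈C uD₁≢uD
        where
        D₁∈F = G′⊆F D₁ D₁∈G′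
        uD₁∈C : (u D₁ , true) ∈ C
        uD₁∈C = let D₁′ , D₁′∈G , D₁≈D₁′ = find (G′⊆G D₁ D₁∈G′) in
          subst (λ w → (w , true) ∈ C) (sym (u-resp D₁∈F D₁≈D₁′)) (proj₂ (selected⁻ C F D₁′∈G))
        uD₁≢uD : (u D₁ , true) ≢ uD
        uD₁≢uD e = D∉G′ (lose D₁∈G′ (u-injective D∈F D₁∈F (sym (cong proj₁ e))))

      C⊆C⁻ : C ⊆ᶜ C⁻
      C⊆C⁻ = minimalC C⁻ (λ y m → proj₁ (remove⁻ uD C m)) (⊨⇒doped-⊨ G′⊆F G′⊨ strip⊆C⁻ u∈C⁻)

    selected-mps : IsMpsFor Gᶜ (strip C)
    selected-mps =
      IsClause-⊆ hC (λ y m → proj₁ (strip⁻ m)) ,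
      doped-⊨⇒⊨ selected-⊆ₛ u-literals-falsified Dop⊨C ,
      selected-minimal

    prime⇒pure-DF : ∃[ G ] (InMps F G × pure (DF d G) ≈ᶜ C)
    prime⇒pure-DF = Gᶜ , inMps , P⊆C , minimalC _ P⊆C (⊨-pure-DF selected-⊆ₛ (proj₂ inMps))
      where
      inMps : InMps F Gᶜ
      inMps = selected-⊆ₛ , strip C , selected-mps
      P⊆C : pure (DF d Gᶜ) ⊆ᶜ C
      P⊆C y y∈P with pure-DF⁻ Gᶜ y∈P
      ... | inj₁ (D , D∈G , refl) = proj₂ (selected⁻ C F D∈G)
      ... | inj₂ y∈PG = proj₁ (strip⁻ (mps-pure⊆ selected-mps y y∈PG))

-- The clauses of F need not be free of complementary pairs.
theorem4p18 : (F : ClauseSet) → IsClauseSet F → (d : Doping F) →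
    ((F' : ClauseSet) → InMps F F' → IsPrimeImplicate (Dop d) (pure (DF d F')))
  × ((F₁ F₂ : ClauseSet) → InMps F F₁ → InMps F F₂ →
       pure (DF d F₁) ≈ᶜ pure (DF d F₂) → F₁ ≋ F₂)
  × ((C : Clause) → IsPrimeImplicate (Dop d) C →
       ∃[ F' ] (InMps F F' × pure (DF d F') ≈ᶜ C))
theorem4p18 F _ d =
    (λ _ → pure-DF-prime)
  , (λ _ _ F₁∈ F₂∈ P₁≈P₂ →
         pure-DF-reflects-⊆ (proj₁ F₁∈) (proj₁ F₂∈) (proj₁ P₁≈P₂)
       , pure-DF-reflects-⊆ (proj₁ F₂∈) (proj₁ F₁∈) (proj₂ P₁≈P₂))
  , (λ _ → prime⇒pure-DF)
  where open Doped d
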